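{- If $C$ is a maximal chain in $[u,w]\subset\mathbb{P}^*$ and $l'$ is any permutation of the label sequence $l(C)$, then $l(C')\le l'$ in lexicographic order, where $C'$ is the chain specified by $l'$.
   Context: $\mathbb{P}^*$ is the set of compositions (words in positive integers) ordered by $u\le w$ iff some subword $w(i_1)\cdots w(i_l)$ with $l=|u|$ satisfies $u(j)\le w(i_j)$ for all $j$. An expansion of a word is obtained by inserting zeros; an embedding of $u$ into $w$ is an expansion $\eta_u$ of $u$ of length $|w|$ with $\eta_u(i)\le w(i)$ for all $i$. An embedding $\eta_y$ of $y$ into an expansion $\eta_x$ of $x$ (where $x$ covers $y$) is normal here meaning: it differs from $\eta_x$ in a single position, decreased by one, and if a $1$ is reduced to $0$, that $1$ is the first element of its run of ones. Each maximal chain $C: w=v_0\gtrdot v_1\gtrdot\cdots\gtrdot v_d=u$ carries embeddings $\eta_{v_0}=w$ and $\eta_{v_{j+1}}$ = the unique normal embedding of $v_{j+1}$ into $\eta_{v_j}$; the edge $v_j\gtrdot v_{j+1}$ is labeled by the position decreased, giving the label sequence $l(C)=(l_1,\dots,l_d)$. Given a permutation $l'=(l_1',\dots,l_d')$ of $l(C)$, define expansions $\eta_{v_0'}=w$ and $\eta_{v_j'}$ obtained from $\eta_{v_{j-1}'}$ by subtracting one at position $l_j'$; the resulting maximal chain $C': w=v_0'\gtrdot\cdots\gtrdot v_d'=u$ is the chain specified by $l'$. -}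

module Defs where

open import Data.Nat using (ℕ; zero; suc; _≤_; _<_; _∸_)
open import Data.List using (List; []; _∷_; length; take; map)
open import Data.List.Relation.Unary.All using (All)
open import Data.List.Relation.Binary.Sublist.Heterogeneous using (Sublist)
open import Data.List.Relation.Binary.Lex.Core using (Lex-≤)
open import Data.Maybe using (Maybe; just; nothing)
open import Data.Product using (_×_)
open import Data.Empty using (⊥)
open import Relation.Binary.PropositionalEquality using (_≡_; _≢_)

-- Words are lists of naturals.  A composition (element of ℙ*) is a word
-- all of whose letters are positive.
IsComp : List ℕ → Set
IsComp = All (0 <_)

-- The order of ℙ*: u ≤ w iff some subword w(i₁)…w(iₗ), l = |u|,
-- satisfies u(j) ≤ w(iⱼ) for all j.
_≤P_ : List ℕ → List ℕ → Set
u ≤P w = Sublist _≤_ u w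

_<P_ : List ℕ → List ℕ → Set
u <P w = (u ≤P w) × (u ≢ w)

_⋗_ : List ℕ → List ℕ → Set
x ⋗ y = (y <P x) × (∀ z → IsComp z → y <P z → z <P x → ⊥)

-- Remove all zeros; η is an expansion of x iff removeZeros η ≡ x.
removeZeros : List ℕ → List ℕ
removeZeros [] = []
removeZeros (zero ∷ xs) = removeZeros xs
removeZeros (suc n ∷ xs) = suc n ∷ removeZeros xs

-- entry at (0-based) position i, 0 when out of range
at : List ℕ → ℕ → ℕ
at [] _ = 0
at (x ∷ xs) zero = x
at (x ∷ xs) (suc i) = at xs i

decAt : ℕ → List ℕ → List ℕ
decAt _ [] = []
decAt zero (x ∷ xs) = (x ∸ 1) ∷ xs
decAt (suc i) (x ∷ xs) = x ∷ decAt i xs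

lastNZ : List ℕ → Maybe ℕ
lastNZ [] = nothing
lastNZ (zero ∷ xs) = lastNZ xs
lastNZ (suc n ∷ xs) with lastNZ xs
... | nothing = just (suc n)
... | just m = just m

-- Normal embedding ηy of y into the expansion ηx, with label i (position decreased):
-- ηy is an expansion of y, it is ηx decreased by one at position i, and if the
-- entry at i is a 1 (reduced to 0) then it is the first element of its run of
-- ones in the underlying word (the previous nonzero entry of ηx is not a 1).
record NormalStep (ηx : List ℕ) (y : List ℕ) (ηy : List ℕ) (i : ℕ) : Set where
  field
    inRange  : i < length ηx
    positive : 1 ≤ at ηx i
    isDec    : ηy ≡ decAt i ηx
    isExp    : removeZeros ηy ≡ y
    firstOne : at ηx i ≡ 1 → lastNZ (take i ηx) ≢ just 1

-- NormalSeq η vs ls : starting from the expansion η of the current element,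
-- the successive elements vs carry normal embeddings with edge labels ls.
data NormalSeq : List ℕ → List (List ℕ) → List ℕ → Set where
  done : ∀ {η} → NormalSeq η [] []
  step : ∀ {η y η′ i vs ls} → NormalStep η y η′ i → NormalSeq η′ vs ls →
         NormalSeq η (y ∷ vs) (i ∷ ls)

-- Labels of a chain w = v₀ ⋗ v₁ ⋗ … (v₁ ∷ … ∷ v_d = vs), with η_{v₀} = w.
Labels : List ℕ → List (List ℕ) → List ℕ → Set
Labels w vs ls = NormalSeq w vs ls

-- Maximal chain w = v₀ ⋗ v₁ ⋗ ⋯ ⋗ v_d = u in [u,w]; vs = v₁ ∷ ⋯ ∷ v_d.
data MaxChain : List ℕ → List (List ℕ) → List ℕ → Set where
  here : ∀ {w} → MaxChain w [] w
  cons : ∀ {w y vs u} → IsComp y → w ⋗ y → MaxChain y vs u → MaxChain w (y ∷ vs) u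

specExps : List ℕ → List ℕ → List (List ℕ)
specExps η [] = []
specExps η (i ∷ is) = decAt i η ∷ specExps (decAt i η) is

specChain : List ℕ → List ℕ → List (List ℕ)
specChain w l′ = map removeZeros (specExps w l′)

_≤lex_ : List ℕ → List ℕ → Set
_≤lex_ = Lex-≤ _≡_ _<_

{-# OPTIONS --safe #-}
-- Let the normal labelling of C′ and l′ first disagree at a step taken from
-- the expansion η, with normal label i and specified label j.  Both decrease η
-- to the same word.  If j < i, comparing the two words shows that every nonzero
-- entry of η from j through i is a 1, so the 1 reduced at i is not the first of
-- its run, contradicting normality.  Hence i < j at the first disagreement.
module Submission where

open import Defs
open import Data.Nat using (ℕ; zero; suc; _+_; _≤_; _<_; s≤s)
open import Data.Nat.Properties using (+-suc; <-cmp; 1+n≢n)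
open import Data.Nat.ListAction using (sum)
open import Data.List using (List; []; _∷_; take; map)
open import Data.List.Properties using (∷-injectiveˡ; ∷-injectiveʳ)
open import Data.List.Relation.Binary.Permutation.Propositional using (_↭_)
open import Data.List.Relation.Binary.Lex.Core using (base; this; next)
open import Data.Maybe using (just; nothing)
open import Data.Product using (_×_; _,_; uncurry)
open import Data.Unit using (tt)
open import Data.Empty using (⊥-elim)
open import Relation.Binary using (tri<; tri≈; tri>)
open import Relation.Binary.PropositionalEquality

sum-removeZeros : ∀ η → sum (removeZeros η) ≡ sum η
sum-removeZeros []          = refl
sum-removeZeros (zero  ∷ η) = sum-removeZeros η
sum-removeZeros (suc n ∷ η) = cong (suc n +_) (sum-removeZeros η)

sum-decAt : ∀ η i → 1 ≤ at η i → suc (sum (decAt i η)) ≡ sum η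
sum-decAt (suc n ∷ η) zero    _ = refl
sum-decAt (x ∷ η)     (suc i) p = trans (sym (+-suc x _)) (cong (x +_) (sum-decAt η i p))

removeZeros-decAt-≢ : ∀ η i → 1 ≤ at η i → removeZeros (decAt i η) ≢ removeZeros η
removeZeros-decAt-≢ η i p eq =
  1+n≢n (trans (cong suc (sym same-sum)) (sum-decAt η i p))
  where
  open ≡-Reasoning
  same-sum : sum (decAt i η) ≡ sum η
  same-sum = begin
    sum (decAt i η)                ≡⟨ sum-removeZeros (decAt i η) ⟨
    sum (removeZeros (decAt i η))  ≡⟨ cong sum eq ⟩
    sum (removeZeros η)            ≡⟨ sum-removeZeros η ⟩
    sum η                          ∎

RepeatedOne : List ℕ → ℕ → Set
RepeatedOne η i = at η i ≡ 1 × lastNZ (take i η) ≡ just 1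

lastNZ-suc-skip-zero : ∀ n t → lastNZ (suc n ∷ zero ∷ t) ≡ lastNZ (suc n ∷ t)
lastNZ-suc-skip-zero n t with lastNZ t
... | nothing = refl
... | just _  = refl

lastNZ-suc-just : ∀ n t {m} → lastNZ t ≡ just m → lastNZ (suc n ∷ t) ≡ just m
lastNZ-suc-just n t eq with lastNZ t
lastNZ-suc-just n t refl | just _ = refl

RepeatedOne-suc : ∀ n η i → RepeatedOne η i → RepeatedOne (suc n ∷ η) (suc i)
RepeatedOne-suc n η i (one , last) = one , lastNZ-suc-just n (take i η) last

RepeatedOne-skip-zero : ∀ n η i → RepeatedOne (suc n ∷ η) (suc i) →
                        RepeatedOne (suc n ∷ zero ∷ η) (suc (suc i))
RepeatedOne-skip-zero n η i (one , last) =
  one , trans (lastNZ-suc-skip-zero n (take i η)) last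

decAt-drops-leading-one : ∀ η k → 1 ≤ at η k →
  removeZeros η ≡ 1 ∷ removeZeros (decAt k η) → RepeatedOne (1 ∷ η) (suc k)
decAt-drops-leading-one (zero ∷ η) (suc k) p eq =
  RepeatedOne-skip-zero 0 η k (decAt-drops-leading-one η k p eq)
decAt-drops-leading-one (1 ∷ η) zero p eq = refl , refl
decAt-drops-leading-one (1 ∷ η) (suc k) p eq =
  RepeatedOne-suc 0 (1 ∷ η) (suc k) (decAt-drops-leading-one η k p (∷-injectiveʳ eq))
decAt-drops-leading-one (suc (suc n) ∷ η) k p eq with () ← ∷-injectiveˡ eq

decAt-collision⇒RepeatedOne : ∀ η i j → j < i → 1 ≤ at η i →
  removeZeros (decAt i η) ≡ removeZeros (decAt j η) → RepeatedOne η i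
decAt-collision⇒RepeatedOne (zero ∷ η) (suc i) zero _ p eq
  with () ← removeZeros-decAt-≢ η i p eq
decAt-collision⇒RepeatedOne (1 ∷ η) (suc i) zero _ p eq =
  decAt-drops-leading-one η i p (sym eq)
decAt-collision⇒RepeatedOne (suc (suc n) ∷ η) (suc i) zero _ p eq
  with () ← ∷-injectiveˡ eq
decAt-collision⇒RepeatedOne (zero ∷ η) (suc i) (suc j) (s≤s j<i) p eq =
  decAt-collision⇒RepeatedOne η i j j<i p eq
decAt-collision⇒RepeatedOne (suc n ∷ η) (suc i) (suc j) (s≤s j<i) p eq =
  RepeatedOne-suc n η i (decAt-collision⇒RepeatedOne η i j j<i p (∷-injectiveʳ eq))

NormalSeq-specExps-≤lex : ∀ η l′ {l″} →
  NormalSeq η (map removeZeros (specExps η l′)) l″ → l″ ≤lex l′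
NormalSeq-specExps-≤lex η []       done = base tt
NormalSeq-specExps-≤lex η (j ∷ l′) (step {i = i} s rest) with <-cmp i j
... | tri< i<j _ _ = this i<j
... | tri≈ _ refl _ rewrite NormalStep.isDec s =
  next refl (NormalSeq-specExps-≤lex (decAt i η) l′ rest)
... | tri> _ _ j<i = ⊥-elim (uncurry (NormalStep.firstOne s)
  (decAt-collision⇒RepeatedOne η i j j<i (NormalStep.positive s) same-word))
  where
  same-word : removeZeros (decAt i η) ≡ removeZeros (decAt j η)
  same-word = trans (cong removeZeros (sym (NormalStep.isDec s))) (NormalStep.isExp s)

-- The comparison holds for every label sequence l′.
lemma4p2 : (u w : List ℕ) → IsComp u → IsComp w →
    (vs : List (List ℕ)) → MaxChain w vs u →
    (l : List ℕ) → Labels w vs l →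
    (l′ : List ℕ) → l′ ↭ l →
    (l″ : List ℕ) → Labels w (specChain w l′) l″ →
    l″ ≤lex l′
lemma4p2 _ w _ _ _ _ _ _ l′ _ _ = NormalSeq-specExps-≤lex w l′
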